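{- Let $S (Z ^{\ell },\sigma )$ be a normalized, properly embedded Dedekind sum, and let $\sigma _{i}$ be a column of $\sigma $. Then $$\bigl\|S (Z ^\ell\cap \sigma_{i}^{\perp } ,\sigma )\bigr\| \leq \bigl\|S (Z ^{\ell },\sigma )\bigr\|.$$
   Context: Dedekind sums $S(L,\sigma,e,v)=\sum'_{x\in L}\mathbf{e}(\langle x,v\rangle)\det\sigma/\prod_j\langle x,\sigma_j\rangle^{e_j}$ (prime: omit terms with vanishing denominator), abbreviated $S(L,\sigma)$ when $e=(1,\dots,1)$ and $v$ fixed. $Z^\ell$ is the span of the first $\ell$ standard basis vectors, $\pi$ the projection onto the first $\ell$ coordinates. Properly embedded: $e=(1,\dots,1)$. Normalized: $L=Z^\ell$, each column restricted to $Z^\ell$ is primitive integral, and columns inducing proportional forms on $Z^\ell$ induce the same form and are adjacent. For a rank-$\ell$ normalized properly embedded sum, the index $\|S\|$ is $\max_I|\det(\pi(\sigma_{i_1}),\dots,\pi(\sigma_{i_\ell}))|$ over $\ell$-element subsets $I$; the index of a lower-rank sum such as $S(Z^\ell\cap\sigma_i^\perp,\sigma)$ is defined after rewriting it (via a rational change of coordinates carrying $Z^\ell\cap\sigma_i^\perp$ to $Z^{\ell-1}$) in normalized form. $\sigma_i^\perp=\{x\mid\langle\sigma_i,x\rangle=0\}$. -}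

module Defs where

open import Data.Nat as ℕ using (ℕ; zero; suc; pred)
open import Data.Nat.GCD using (gcd)
open import Data.Integer as ℤ using (ℤ; +_; -_; ∣_∣)
open import Data.Integer.DivMod using (_/ℕ_)
open import Data.Fin as Fin using (Fin; zero; suc; toℕ; punchIn; inject≤)
open import Data.List using (List; []; _∷_; map; foldr; concatMap; allFin)
open import Data.Product using (Σ; _×_; ∃; ∃-syntax; _,_)
open import Relation.Binary.PropositionalEquality using (_≡_; _≢_)
open import Data.Rational as ℚ using (ℚ)

-- Integer vectors / matrices as functions.  A "matrix" M : Fin m → Fin m → ℤ
-- is indexed as  M row column.

sumℤ : ∀ {m} → (Fin m → ℤ) → ℤ
sumℤ {zero}  f = + 0
sumℤ {suc m} f = f zero ℤ.+ sumℤ (λ k → f (suc k))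

⟨_,_⟩ : ∀ {m} → (Fin m → ℤ) → (Fin m → ℤ) → ℤ
⟨ x , y ⟩ = sumℤ (λ k → x k ℤ.* y k)

sign : ℕ → ℤ
sign zero          = + 1
sign (suc zero)    = - (+ 1)
sign (suc (suc k)) = sign k

det : ∀ {m} → (Fin m → Fin m → ℤ) → ℤ
det {zero}  M = + 1
det {suc m} M =
  sumℤ (λ j → sign (toℕ j) ℤ.* M zero j ℤ.* det (λ r c → M (suc r) (punchIn j c)))

-- Finite maxima over all maps Fin k → Fin n (i.e. all ordered k-tuples of
-- column indices; non-injective tuples give determinant 0 and permuting a
-- tuple does not change |det|, so this is the max over k-element subsets).

allTuples : (k n : ℕ) → List (Fin k → Fin n)
allTuples zero    n = (λ ()) ∷ []
allTuples (suc k) n =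
  concatMap (λ i → map (λ f → λ { zero → i ; (suc c) → f c }) (allTuples k n)) (allFin n)

maxList : List ℕ → ℕ
maxList = foldr ℕ._⊔_ 0

content : ∀ {m} → (Fin m → ℤ) → ℕ
content {m} v = foldr (λ k acc → gcd ∣ v k ∣ acc) 0 (allFin m)

Primitive : ∀ {m} → (Fin m → ℤ) → Set
Primitive v = content v ≡ 1

-- exact division by a natural number (identity when dividing by 0)
divBy : ℤ → ℕ → ℤ
divBy x zero    = x
divBy x (suc d) = x /ℕ suc d

-- primitive part of an integer vector (the zero vector stays zero)
primPart : ∀ {m} → (Fin m → ℤ) → (Fin m → ℤ)
primPart v k = divBy (v k) (content v)

Proportional : ∀ {m} → (Fin m → ℤ) → (Fin m → ℤ) → Set
Proportional u w = Σ ℤ λ c → Σ ℤ λ d → c ≢ + 0 × d ≢ + 0 × (∀ r → c ℤ.* u r ≡ d ℤ.* w r)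

-- Data of a Dedekind sum S(Z^ℓ, σ, e, v) relevant here.
-- σ : Fin n → Fin n → ℚ  is indexed  σ column coordinate, so  σ j  is the
-- column σ_j ∈ ℚ^n.  a j : Fin ℓ → ℤ  is the (integral) restriction π(σ_j) of
-- the form ⟨·,σ_j⟩ to Z^ℓ, i.e.  σ j (inject≤ k ℓ≤n) = a j k.

IsRestriction : ∀ {ℓ n} → .(ℓ ℕ.≤ n) → (Fin n → Fin n → ℚ) → (Fin n → Fin ℓ → ℤ) → Set
IsRestriction {ℓ} {n} ℓ≤n σ a = ∀ (j : Fin n) (k : Fin ℓ) → σ j (inject≤ k ℓ≤n) ≡ (a j k ℚ./ 1)

-- Normalized (with L = Z^ℓ): every restricted column is primitive integral,
-- and columns inducing proportional forms on Z^ℓ induce the same form and are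
-- adjacent (every column between them induces that same form).
Normalized : ∀ {ℓ n} → (Fin n → Fin ℓ → ℤ) → Set
Normalized {ℓ} {n} a =
  (∀ j → Primitive (a j)) ×
  (∀ j k → Proportional (a j) (a k) →
     (∀ r → a j r ≡ a k r) ×
     (∀ m → toℕ j ℕ.≤ toℕ m → toℕ m ℕ.≤ toℕ k → ∀ r → a m r ≡ a j r))

index : ∀ {ℓ n} → (Fin n → Fin ℓ → ℤ) → ℕ
index {ℓ} {n} a = maxList (map (λ I → ∣ det (λ r c → a (I c) r) ∣) (allTuples ℓ n))

-- The lower-rank sum S(Z^ℓ ∩ σ_i^⊥, σ).
-- B : Fin (pred ℓ) → Fin ℓ → ℤ  (B c = c-th basis vector) is a ℤ-basis of the
-- lattice  Z^ℓ ∩ σ_i^⊥ = { x ∈ ℤ^ℓ | ⟨x, π(σ_i)⟩ = 0 }.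

combo : ∀ {ℓ p} → (Fin p → Fin ℓ → ℤ) → (Fin p → ℤ) → (Fin ℓ → ℤ)
combo B y r = sumℤ (λ c → y c ℤ.* B c r)

IsLatticeBasisOfPerp : ∀ {ℓ p} → (Fin ℓ → ℤ) → (Fin p → Fin ℓ → ℤ) → Set
IsLatticeBasisOfPerp {ℓ} {p} u B =
  (∀ c → ⟨ B c , u ⟩ ≡ + 0) ×
  (∀ (x : Fin ℓ → ℤ) → ⟨ x , u ⟩ ≡ + 0 → ∃[ y ] (∀ r → combo B y r ≡ x r)) ×
  (∀ (y : Fin p → ℤ) → (∀ r → combo B y r ≡ + 0) → ∀ c → y c ≡ + 0)

-- Coordinates y ∈ Z^{ℓ-1} ↦ By ∈ Z^ℓ ∩ σ_i^⊥ (the coordinate change carrying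
-- the lattice to Z^{ℓ-1}).  The form ⟨·,σ_j⟩ becomes y ↦ ⟨y, Bᵀπ(σ_j)⟩; we then
-- normalize it to be primitive (forms vanishing on the lattice stay 0 and
-- contribute determinant 0, the same as discarding them).
restrictedForm : ∀ {ℓ p} → (Fin p → Fin ℓ → ℤ) → (Fin ℓ → ℤ) → (Fin p → ℤ)
restrictedForm B u = primPart (λ c → ⟨ B c , u ⟩)

indexPerp : ∀ {ℓ n} → (Fin n → Fin ℓ → ℤ) → (Fin (pred ℓ) → Fin ℓ → ℤ) → ℕ
indexPerp {ℓ} {n} a B = index (λ j → restrictedForm B (a j))

-- Let u = π(σ_i). As u is primitive, Bézout gives v with ⟨v,u⟩ = 1, and then every
-- x ∈ ℤ^ℓ is u⟨v,x⟩ plus an element of Z^ℓ ∩ σ_i^⊥, i.e. an integral combination of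
-- the basis B. Hence for any columns a_{j₁},…,a_{j_{ℓ-1}} the matrices X = (u | a_j) and
-- Y = (v ; B)·X each factor through the other, so |det Y| = |det X| ≤ ‖S(Z^ℓ,σ)‖. The
-- first column of Y is e₀, so det Y is the determinant of the restricted forms
-- ⟨B_d, a_{j_c}⟩; normalising these to their primitive parts divides each column by a
-- positive integer and can only decrease |det|. Multiplicativity of the Laplace determinant comes from
-- the uniqueness of alternating multilinear forms.

module Submission where

open import Defs
import Algebra.Properties.CommutativeMonoid.Sum as CommutativeMonoidSum
import Algebra.Properties.Semiring.Sum as SemiringSum
open import Data.Empty using (⊥-elim)
open import Data.Fin as Fin using (Fin; zero; suc; toℕ; punchIn; punchOut; inject₁)
open import Data.Fin.Induction using (<-weakInduction)
import Data.Fin.Properties as FinP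
open import Data.Integer using (ℤ; +_; -_; -[1+_]; _+_; _*_; ∣_∣)
open import Data.Integer.DivMod using (_/ℕ_)
import Data.Integer.Properties as ℤP
open import Data.Integer.Tactic.RingSolver using (solve-∀)
open import Data.List using (List; []; _∷_; allFin; foldr; map)
open import Data.List.Membership.Propositional using (_∈_; _∉_; lose)
open import Data.List.Membership.Propositional.Properties using (∈-allFin)
open import Data.List.Relation.Unary.Any as Any using (Any; here; there)
open import Data.List.Relation.Unary.Any.Properties using (concatMap⁺; map⁺)
open import Data.Nat as ℕ using (ℕ; zero; suc; _≤_; z≤n; s≤s; pred)
open import Data.Nat.Divisibility using (_∣_; ∣-trans; ∣-antisym; divides; n∣m⇒m%n≡0)
open import Data.Nat.DivMod using (m/n*n≡m)
open import Data.Nat.GCD using (gcd; gcd[m,n]∣m; gcd[m,n]∣n; gcd-GCD; module Bézout)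
import Data.Nat.Properties as ℕP
open import Data.Product using (_×_; ∃-syntax; _,_; proj₁; proj₂)
open import Data.Rational using (ℚ)
open import Data.Vec.Functional using (updateAt; tail; insertAt)
open import Data.Vec.Functional.Properties using (updateAt-updates; updateAt-minimal; insertAt-lookup; insertAt-punchIn)
open import Function using (_∘_; case_of_)
open import Relation.Binary.PropositionalEquality
open import Relation.Nullary using (yes; no; Dec)

Row : ℕ → Set
Row m = Fin m → ℤ

Mat : ℕ → Set
Mat m = Fin m → Fin m → ℤ

private
  module Σℤ = SemiringSum ℤP.+-*-semiring
  module Πℤ = CommutativeMonoidSum ℤP.*-1-commutativeMonoid

sumℤ≡sum : ∀ {m} (f : Row m) → sumℤ f ≡ Σℤ.sum f
sumℤ≡sum {zero}  f = refl
sumℤ≡sum {suc m} f = cong (_+_ (f zero)) (sumℤ≡sum (f ∘ suc))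

sumℤ-cong : ∀ {m} {f g : Row m} → (∀ k → f k ≡ g k) → sumℤ f ≡ sumℤ g
sumℤ-cong {zero}  f≗g = refl
sumℤ-cong {suc m} f≗g = cong₂ _+_ (f≗g zero) (sumℤ-cong (f≗g ∘ suc))

sumℤ-zero : ∀ {m} {f : Row m} → (∀ k → f k ≡ + 0) → sumℤ f ≡ + 0
sumℤ-zero {zero}  f≗0 = refl
sumℤ-zero {suc m} f≗0 = cong₂ _+_ (f≗0 zero) (sumℤ-zero (f≗0 ∘ suc))

sumℤ-+ : ∀ {m} (f g : Row m) → sumℤ (λ k → f k + g k) ≡ sumℤ f + sumℤ g
sumℤ-+ f g = begin
  sumℤ (λ k → f k + g k)   ≡⟨ sumℤ≡sum (λ k → f k + g k) ⟩
  Σℤ.sum (λ k → f k + g k) ≡⟨ Σℤ.∑-distrib-+ f g ⟩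
  Σℤ.sum f + Σℤ.sum g      ≡⟨ sym (cong₂ _+_ (sumℤ≡sum f) (sumℤ≡sum g)) ⟩
  sumℤ f + sumℤ g          ∎
  where open ≡-Reasoning

*-distribˡ-sumℤ : ∀ {m} (t : ℤ) (f : Row m) → t * sumℤ f ≡ sumℤ (λ k → t * f k)
*-distribˡ-sumℤ t f = begin
  t * sumℤ f               ≡⟨ cong (t *_) (sumℤ≡sum f) ⟩
  t * Σℤ.sum f             ≡⟨ Σℤ.*-distribˡ-sum t f ⟩
  Σℤ.sum (λ k → t * f k)   ≡⟨ sym (sumℤ≡sum (λ k → t * f k)) ⟩
  sumℤ (λ k → t * f k)     ∎
  where open ≡-Reasoning

sumℤ-neg : ∀ {m} (f : Row m) → sumℤ (λ k → - f k) ≡ - sumℤ f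
sumℤ-neg f = begin
  sumℤ (λ k → - f k)        ≡⟨ sumℤ-cong (λ k → sym (ℤP.-1*i≡-i (f k))) ⟩
  sumℤ (λ k → - + 1 * f k)  ≡⟨ sym (*-distribˡ-sumℤ (- + 1) f) ⟩
  - + 1 * sumℤ f            ≡⟨ ℤP.-1*i≡-i _ ⟩
  - sumℤ f                  ∎
  where open ≡-Reasoning

sumℤ-linear : ∀ {m} {h f g : Row m} t → (∀ k → h k ≡ t * f k + g k) →
  sumℤ h ≡ t * sumℤ f + sumℤ g
sumℤ-linear {h = h} {f} {g} t h≗tf+g = begin
  sumℤ h                              ≡⟨ sumℤ-cong h≗tf+g ⟩
  sumℤ (λ k → t * f k + g k)          ≡⟨ sumℤ-+ (λ k → t * f k) g ⟩
  sumℤ (λ k → t * f k) + sumℤ g       ≡⟨ cong (_+ sumℤ g) (sym (*-distribˡ-sumℤ t f)) ⟩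
  t * sumℤ f + sumℤ g                 ∎
  where open ≡-Reasoning

sumℤ-comm : ∀ {m p} (f : Fin m → Fin p → ℤ) →
  sumℤ (λ j → sumℤ (f j)) ≡ sumℤ (λ k → sumℤ (λ j → f j k))
sumℤ-comm f = begin
  sumℤ (λ j → sumℤ (f j))                  ≡⟨ sumℤ-cong (λ j → sumℤ≡sum (f j)) ⟩
  sumℤ (λ j → Σℤ.sum (f j))                ≡⟨ sumℤ≡sum (λ j → Σℤ.sum (f j)) ⟩
  Σℤ.sum (λ j → Σℤ.sum (f j))              ≡⟨ Σℤ.∑-comm f ⟩
  Σℤ.sum (λ k → Σℤ.sum (λ j → f j k))      ≡⟨ sym (sumℤ≡sum (λ k → Σℤ.sum (λ j → f j k))) ⟩
  sumℤ (λ k → Σℤ.sum (λ j → f j k))        ≡⟨ sumℤ-cong (λ k → sym (sumℤ≡sum (λ j → f j k))) ⟩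
  sumℤ (λ k → sumℤ (λ j → f j k))          ∎
  where open ≡-Reasoning

sumℤ-punchIn : ∀ {m} (j : Fin (suc m)) (f : Fin (suc m) → ℤ) →
  sumℤ f ≡ f j + sumℤ (f ∘ punchIn j)
sumℤ-punchIn j f = begin
  sumℤ f                        ≡⟨ sumℤ≡sum f ⟩
  Σℤ.sum f                      ≡⟨ Σℤ.sum-remove {i = j} f ⟩
  f j + Σℤ.sum (f ∘ punchIn j)  ≡⟨ cong (_+_ (f j)) (sym (sumℤ≡sum (f ∘ punchIn j))) ⟩
  f j + sumℤ (f ∘ punchIn j)    ∎
  where open ≡-Reasoning

*-distribʳ-sumℤ : ∀ {m} (t : ℤ) (f : Row m) → sumℤ f * t ≡ sumℤ (λ k → f k * t)
*-distribʳ-sumℤ t f = trans (ℤP.*-comm (sumℤ f) t) (trans (*-distribˡ-sumℤ t f) (sumℤ-cong (λ k → ℤP.*-comm t (f k))))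

unit : ∀ {m} → Fin m → Row m
unit k c with k Fin.≟ c
... | yes _ = + 1
... | no  _ = + 0

unit-diag : ∀ {m} (k : Fin m) → unit k k ≡ + 1
unit-diag k with k Fin.≟ k
... | yes _   = refl
... | no  k≢k = ⊥-elim (k≢k refl)

unit-off : ∀ {m} {k c : Fin m} → k ≢ c → unit k c ≡ + 0
unit-off {k = k} {c} k≢c with k Fin.≟ c
... | yes k≡c = ⊥-elim (k≢c k≡c)
... | no  _   = refl

unit-sym : ∀ {m} (k c : Fin m) → unit k c ≡ unit c k
unit-sym k c with k Fin.≟ c | c Fin.≟ k
... | yes _   | yes _   = refl
... | no  _   | no  _   = refl
... | yes k≡c | no  c≢k = ⊥-elim (c≢k (sym k≡c))
... | no  k≢c | yes c≡k = ⊥-elim (k≢c (sym c≡k))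

sumℤ-unit : ∀ {m} (j : Fin m) (f : Row m) → sumℤ (λ k → unit j k * f k) ≡ f j
sumℤ-unit {suc m} j f = begin
  sumℤ (λ k → unit j k * f k)                        ≡⟨ sumℤ-punchIn j (λ k → unit j k * f k) ⟩
  unit j j * f j + sumℤ (λ k → unit j (punchIn j k) * f (punchIn j k))
    ≡⟨ cong₂ _+_ (cong (_* f j) (unit-diag j)) (sumℤ-zero off-diagonal) ⟩
  + 1 * f j + + 0                                    ≡⟨ ℤP.+-identityʳ _ ⟩
  + 1 * f j                                          ≡⟨ ℤP.*-identityˡ (f j) ⟩
  f j                                                ∎
  where
  open ≡-Reasoning
  off-diagonal : ∀ k → unit j (punchIn j k) * f (punchIn j k) ≡ + 0
  off-diagonal k = cong (_* f (punchIn j k)) (unit-off (FinP.punchInᵢ≢i j k ∘ sym))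

unit-expansion : ∀ {m} (x : Row m) c → x c ≡ sumℤ (λ k → x k * unit k c)
unit-expansion x c = sym (trans (sumℤ-cong (λ k → trans (ℤP.*-comm (x k) (unit k c)) (cong (_* x k) (unit-sym k c))))
                                (sumℤ-unit c x))

unit-cong-↔ : ∀ {m n} {a b : Fin m} {a′ b′ : Fin n} → (a ≡ b → a′ ≡ b′) → (a′ ≡ b′ → a ≡ b) →
  unit a b ≡ unit a′ b′
unit-cong-↔ {a = a} {b} {a′} {b′} to from with a Fin.≟ b | a′ Fin.≟ b′
... | yes _   | yes _    = refl
... | no _    | no _     = refl
... | yes a≡b | no a′≢b′ = ⊥-elim (a′≢b′ (to a≡b))
... | no a≢b  | yes a′≡b′ = ⊥-elim (a≢b (from a′≡b′))

setRow : ∀ {A : Set} {n} → (Fin n → A) → Fin n → A → (Fin n → A)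
setRow M r x = updateAt M r (λ _ → x)

setRow-same : ∀ {A : Set} {n} (M : Fin n → A) r x → setRow M r x r ≡ x
setRow-same M r x = updateAt-updates r M

setRow-other : ∀ {A : Set} {n} (M : Fin n → A) {r r'} x → r' ≢ r → setRow M r x r' ≡ M r'
setRow-other M {r} {r'} x r'≢r = updateAt-minimal r' r M r'≢r

setRow-map : ∀ {A B : Set} {n} (F : A → B) (M : Fin n → A) r x r' →
  F (setRow M r x r') ≡ setRow (F ∘ M) r (F x) r'
setRow-map F M r x r' with r' Fin.≟ r
... | yes refl = trans (cong F (setRow-same M r x)) (sym (setRow-same (F ∘ M) r (F x)))
... | no r'≢r  = trans (cong F (setRow-other M x r'≢r)) (sym (setRow-other (F ∘ M) (F x) r'≢r))

setRow-self : ∀ {A : Set} {n} (M : Fin n → A) r r' → setRow M r (M r) r' ≡ M r'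
setRow-self M r r' with r' Fin.≟ r
... | yes refl = setRow-same M r (M r)
... | no r'≢r  = setRow-other M (M r) r'≢r

setRow-comm : ∀ {A : Set} {n} (M : Fin n → A) {r s} x y → r ≢ s → ∀ r' →
  setRow (setRow M r x) s y r' ≡ setRow (setRow M s y) r x r'
setRow-comm M {r} {s} x y r≢s r' with r' Fin.≟ r | r' Fin.≟ s
... | yes refl | yes refl = ⊥-elim (r≢s refl)
... | yes refl | no r≢s'  = trans (setRow-other _ y r≢s) (trans (setRow-same M r x) (sym (setRow-same _ r x)))
... | no r'≢r  | yes refl = trans (setRow-same _ s y) (sym (trans (setRow-other _ x r'≢r) (setRow-same M s y)))
... | no r'≢r  | no r'≢s  = trans (setRow-other _ y r'≢s) (trans (setRow-other M x r'≢r)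
                              (sym (trans (setRow-other _ x r'≢r) (setRow-other M y r'≢s))))

setRow-cong : ∀ {m} (M : Mat m) r {x y : Row m} → (∀ c → x c ≡ y c) → ∀ r' c →
  setRow M r x r' c ≡ setRow M r y r' c
setRow-cong M r {x} {y} x≗y r' c with r' Fin.≟ r
... | yes refl = trans (cong-app (setRow-same M r x) c) (trans (x≗y c) (sym (cong-app (setRow-same M r y) c)))
... | no r'≢r  = trans (cong-app (setRow-other M x r'≢r) c) (sym (cong-app (setRow-other M y r'≢r) c))

swapRows : ∀ {A : Set} {n} → (Fin n → A) → Fin n → Fin n → (Fin n → A)
swapRows M r s = setRow (setRow M r (M s)) s (M r)

swapRows-fst : ∀ {A : Set} {n} (M : Fin n → A) {r s} → r ≢ s → swapRows M r s r ≡ M s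
swapRows-fst M {r} {s} r≢s = trans (setRow-other _ (M r) r≢s) (setRow-same M r (M s))

swapRows-snd : ∀ {A : Set} {n} (M : Fin n → A) r s → swapRows M r s s ≡ M r
swapRows-snd M r s = setRow-same _ s (M r)

swapRows-other : ∀ {A : Set} {n} (M : Fin n → A) {r s r'} → r' ≢ r → r' ≢ s → swapRows M r s r' ≡ M r'
swapRows-other M {r} {s} r'≢r r'≢s = trans (setRow-other _ (M r) r'≢s) (setRow-other M (M s) r'≢r)

swapRows-map : ∀ {A B : Set} {n} (F : A → B) (M : Fin n → A) {r s} → r ≢ s → ∀ r' →
  F (swapRows M r s r') ≡ swapRows (F ∘ M) r s r'
swapRows-map F M {r} {s} r≢s r' with r' Fin.≟ s | r' Fin.≟ r
... | yes refl | _        = trans (cong F (swapRows-snd M r s)) (sym (swapRows-snd (F ∘ M) r s))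
... | no r'≢s  | yes refl = trans (cong F (swapRows-fst M r≢s)) (sym (swapRows-fst (F ∘ M) r≢s))
... | no r'≢s  | no r'≢r  = trans (cong F (swapRows-other M r'≢r r'≢s)) (sym (swapRows-other (F ∘ M) r'≢r r'≢s))

insertAt-punchOut : ∀ {A : Set} {n} (xs : Fin n → A) {k c} v (k≢c : k ≢ c) → insertAt xs k v c ≡ xs (punchOut k≢c)
insertAt-punchOut xs {k} v k≢c = begin
  insertAt xs k v _                              ≡⟨ cong (insertAt xs k v) (sym (FinP.punchIn-punchOut k≢c)) ⟩
  insertAt xs k v (punchIn k (punchOut k≢c))     ≡⟨ insertAt-punchIn xs k v (punchOut k≢c) ⟩
  xs (punchOut k≢c)                              ∎
  where open ≡-Reasoning

insertAt-cong : ∀ {m} k {x y : Row m} → (∀ c → x c ≡ y c) → ∀ c → insertAt x k (+ 0) c ≡ insertAt y k (+ 0) c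
insertAt-cong k {x} {y} x≗y c with k Fin.≟ c
... | yes refl = trans (insertAt-lookup x k (+ 0)) (sym (insertAt-lookup y k (+ 0)))
... | no k≢c   = trans (insertAt-punchOut x (+ 0) k≢c) (trans (x≗y (punchOut k≢c)) (sym (insertAt-punchOut y (+ 0) k≢c)))

insertAt-linear : ∀ {m} k t (x y : Row m) c →
  insertAt (λ c → t * x c + y c) k (+ 0) c ≡ t * insertAt x k (+ 0) c + insertAt y k (+ 0) c
insertAt-linear k t x y c with k Fin.≟ c
... | yes refl = begin
  insertAt (λ c → t * x c + y c) k (+ 0) k               ≡⟨ insertAt-lookup _ k (+ 0) ⟩
  + 0                                                    ≡⟨ absorb t ⟩
  t * + 0 + + 0
    ≡⟨ sym (cong₂ (λ a b → t * a + b) (insertAt-lookup x k (+ 0)) (insertAt-lookup y k (+ 0))) ⟩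
  t * insertAt x k (+ 0) k + insertAt y k (+ 0) k        ∎
  where
  open ≡-Reasoning
  absorb : ∀ t → + 0 ≡ t * + 0 + + 0
  absorb = solve-∀
... | no k≢c = trans (insertAt-punchOut _ (+ 0) k≢c)
  (sym (cong₂ (λ a b → t * a + b) (insertAt-punchOut x (+ 0) k≢c) (insertAt-punchOut y (+ 0) k≢c)))

sign-suc : ∀ k → sign (suc k) ≡ - sign k
sign-suc zero          = refl
sign-suc (suc zero)    = refl
sign-suc (suc (suc k)) = sign-suc k

minor : ∀ {m} → Fin (suc m) → Mat (suc m) → Mat m
minor j M r c = M (suc r) (punchIn j c)

expansionTerm : ∀ {m} → Mat (suc m) → Fin (suc m) → ℤ
expansionTerm M j = sign (toℕ j) * M zero j * det (minor j M)

det-cong : ∀ {m} {M N : Mat m} → (∀ r c → M r c ≡ N r c) → det M ≡ det N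
det-cong {zero}  M≗N = refl
det-cong {suc m} M≗N = sumℤ-cong λ j →
  cong₂ _*_ (cong (sign (toℕ j) *_) (M≗N zero j)) (det-cong (λ r c → M≗N (suc r) (punchIn j c)))

Extensional : ∀ {m} → (Mat m → ℤ) → Set
Extensional G = ∀ {M N} → (∀ r c → M r c ≡ N r c) → G M ≡ G N

RowLinear : ∀ {m} → (Mat m → ℤ) → Set
RowLinear {m} G = ∀ (M : Mat m) r t (x y : Row m) →
  G (setRow M r (λ c → t * x c + y c)) ≡ t * G (setRow M r x) + G (setRow M r y)

Alternating : ∀ {m} → (Mat m → ℤ) → Set
Alternating {m} G = ∀ (M : Mat m) {r s} → r ≢ s → (∀ c → M r c ≡ M s c) → G M ≡ + 0

det-rowLinear : ∀ {m} → RowLinear (det {m})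
det-rowLinear {suc m} M zero t x y = sumℤ-linear t λ j →
  distrib t (sign (toℕ j)) (x j) (y j) (det (minor j M))
  where
  distrib : ∀ t s a b d → s * (t * a + b) * d ≡ t * (s * a * d) + s * b * d
  distrib = solve-∀
det-rowLinear {suc m} M (suc r) t x y = sumℤ-linear t λ j → begin
  S j * det (minor j (setRow M (suc r) z))
    ≡⟨ cong (S j *_) (trans (minor-setRow j z) (det-rowLinear (minor j M) r t _ _)) ⟩
  S j * (t * det (setRow (minor j M) r (x ∘ punchIn j)) + det (setRow (minor j M) r (y ∘ punchIn j)))
    ≡⟨ distrib t (S j) _ _ ⟩
  t * (S j * det (setRow (minor j M) r (x ∘ punchIn j))) + S j * det (setRow (minor j M) r (y ∘ punchIn j))
    ≡⟨ sym (cong₂ (λ p q → t * (S j * p) + S j * q) (minor-setRow j x) (minor-setRow j y)) ⟩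
  t * (S j * det (minor j (setRow M (suc r) x))) + S j * det (minor j (setRow M (suc r) y)) ∎
  where
  open ≡-Reasoning
  z : Row (suc m)
  z c = t * x c + y c
  S : Fin (suc m) → ℤ
  S j = sign (toℕ j) * M zero j
  minor-setRow : ∀ j w → det (minor j (setRow M (suc r) w)) ≡ det (setRow (minor j M) r (w ∘ punchIn j))
  minor-setRow j w = det-cong (λ r' c → cong-app (setRow-map (_∘ punchIn j) (tail M) r w r') c)
  distrib : ∀ t s a b → s * (t * a + b) ≡ t * (s * a) + s * b
  distrib = solve-∀

record IsAlternatingForm {m} (G : Mat m → ℤ) : Set where
  field
    ext         : Extensional G
    rowLinear   : RowLinear G
    alternating : Alternating G

module AlternatingForm {m} {G : Mat m → ℤ} (isAlternatingForm : IsAlternatingForm G) where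
  open IsAlternatingForm isAlternatingForm

  zeroRow : ∀ M r → G (setRow M r (λ _ → + 0)) ≡ + 0
  zeroRow M r = trans (rowLinear M r (- + 1) z z) (cancel (G (setRow M r z)))
    where
    z : Row m
    z _ = + 0
    cancel : ∀ a → - + 1 * a + a ≡ + 0
    cancel = solve-∀

  rowAdditive : ∀ M r (x y : Row m) →
    G (setRow M r (λ c → x c + y c)) ≡ G (setRow M r x) + G (setRow M r y)
  rowAdditive M r x y = begin
    G (setRow M r (λ c → x c + y c))          ≡⟨ ext (setRow-cong M r (λ c → cong (_+ y c) (sym (ℤP.*-identityˡ (x c))))) ⟩
    G (setRow M r (λ c → + 1 * x c + y c))    ≡⟨ rowLinear M r (+ 1) x y ⟩
    + 1 * G (setRow M r x) + G (setRow M r y) ≡⟨ cong (_+ G (setRow M r y)) (ℤP.*-identityˡ (G (setRow M r x))) ⟩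
    G (setRow M r x) + G (setRow M r y)       ∎
    where open ≡-Reasoning

  -- G vanishes on W (x+y) (x+y), W x x and W y y; expanding the first in rows r and s
  -- leaves G (W x y) + G (W y x) = 0.
  swapRows-neg : ∀ M {r s} → r ≢ s → G (swapRows M r s) ≡ - G M
  swapRows-neg M {r} {s} r≢s = begin
    G (W y x)   ≡⟨ cancel _ _ _ _ (trans (sym expand) (W-repeated (λ c → x c + y c))) (W-repeated x) (W-repeated y) ⟩
    - G (W x y) ≡⟨ cong -_ (ext W-x-y≈M) ⟩
    - G M       ∎
    where
    open ≡-Reasoning
    x = M r
    y = M s
    W : Row m → Row m → Mat m
    W u v = setRow (setRow M r u) s v
    W-repeated : ∀ u → G (W u u) ≡ + 0
    W-repeated u = alternating (W u u) r≢s
      (cong-app (trans (trans (setRow-other _ u r≢s) (setRow-same M r u)) (sym (setRow-same _ s u))))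
    additiveʳ : ∀ u v w → G (W (λ c → u c + v c) w) ≡ G (W u w) + G (W v w)
    additiveʳ u v w = begin
      G (W (λ c → u c + v c) w)                                    ≡⟨ ext (λ r' → cong-app (setRow-comm M _ w r≢s r')) ⟩
      G (setRow (setRow M s w) r (λ c → u c + v c))                ≡⟨ rowAdditive (setRow M s w) r u v ⟩
      G (setRow (setRow M s w) r u) + G (setRow (setRow M s w) r v)
        ≡⟨ sym (cong₂ _+_ (ext (λ r' → cong-app (setRow-comm M u w r≢s r'))) (ext (λ r' → cong-app (setRow-comm M v w r≢s r')))) ⟩
      G (W u w) + G (W v w)                                        ∎
    expand : G (W (λ c → x c + y c) (λ c → x c + y c)) ≡ (G (W x x) + G (W x y)) + (G (W y x) + G (W y y))
    expand = trans (additiveʳ x y _) (cong₂ _+_ (rowAdditive (setRow M r x) s x y) (rowAdditive (setRow M r y) s x y))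
    W-x-y≈M : ∀ r' c → W x y r' c ≡ M r' c
    W-x-y≈M r' c with r' Fin.≟ s
    ... | yes refl = cong-app (setRow-same _ s y) c
    ... | no r'≢s  = cong-app (trans (setRow-other _ y r'≢s) (setRow-self M r r')) c
    cancel : ∀ a b c d → (a + b) + (c + d) ≡ + 0 → a ≡ + 0 → d ≡ + 0 → c ≡ - b
    cancel _ b c _ sum≡0 refl refl = begin
      c                                  ≡⟨ rearrange b c ⟩
      - b + ((+ 0 + b) + (c + + 0))      ≡⟨ cong (_+_ (- b)) sum≡0 ⟩
      - b + + 0                          ≡⟨ ℤP.+-identityʳ (- b) ⟩
      - b                                ∎
      where
      rearrange : ∀ b c → c ≡ - b + ((+ 0 + b) + (c + + 0))
      rearrange = solve-∀

  addRowMultiple : ∀ M {r s} t → r ≢ s → G (setRow M r (λ c → t * M s c + M r c)) ≡ G M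
  addRowMultiple M {r} {s} t r≢s = begin
    G (setRow M r (λ c → t * M s c + M r c))             ≡⟨ rowLinear M r t (M s) (M r) ⟩
    t * G (setRow M r (M s)) + G (setRow M r (M r))
      ≡⟨ cong₂ (λ a b → t * a + b) repeated (ext (λ r' → cong-app (setRow-self M r r'))) ⟩
    t * + 0 + G M                                         ≡⟨ cong (_+ G M) (ℤP.*-zeroʳ t) ⟩
    + 0 + G M                                             ≡⟨ ℤP.+-identityˡ (G M) ⟩
    G M                                                   ∎
    where
    open ≡-Reasoning
    repeated : G (setRow M r (M s)) ≡ + 0
    repeated = alternating (setRow M r (M s)) r≢s
      (cong-app (trans (setRow-same M r (M s)) (sym (setRow-other M (M s) (r≢s ∘ sym)))))

  addMultiplesOfRow : ∀ M s (κ : Row m) → κ s ≡ + 0 → G (λ r c → κ r * M s c + M r c) ≡ G M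
  addMultiplesOfRow M s κ κs≡0 = go (allFin m) κ κs≡0 (λ r r∉ → ⊥-elim (r∉ (∈-allFin r)))
    where
    go : ∀ L (κ : Row m) → κ s ≡ + 0 → (∀ r → r ∉ L → κ r ≡ + 0) → G (λ r c → κ r * M s c + M r c) ≡ G M
    go [] κ _ outside≡0 = ext λ r c → trans (cong (λ a → a * M s c + M r c) (outside≡0 r λ ())) (ℤP.+-identityˡ (M r c))
    go (r ∷ L) κ κs≡0 outside≡0 with r Fin.≟ s
    ... | yes refl = go L κ κs≡0 λ r' r'∉L → case r' Fin.≟ r of λ where
      (yes refl) → κs≡0
      (no r'≢r)  → outside≡0 r' λ { (here r'≡r) → r'≢r r'≡r ; (there r'∈L) → r'∉L r'∈L }
    ... | no r≢s = begin
      G (λ r' c → κ r' * M s c + M r' c)                 ≡⟨ ext split ⟩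
      G (setRow P r (λ c → κ r * P s c + P r c))         ≡⟨ addRowMultiple P (κ r) r≢s ⟩
      G P                                                 ≡⟨ go L κ′ κ′s≡0 outside′≡0 ⟩
      G M                                                 ∎
      where
      open ≡-Reasoning
      κ′ : Row m
      κ′ = setRow κ r (+ 0)
      P : Mat m
      P r' c = κ′ r' * M s c + M r' c
      κ′s≡0 : κ′ s ≡ + 0
      κ′s≡0 = trans (setRow-other κ (+ 0) (r≢s ∘ sym)) κs≡0
      outside′≡0 : ∀ r' → r' ∉ L → κ′ r' ≡ + 0
      outside′≡0 r' r'∉L with r' Fin.≟ r
      ... | yes refl = setRow-same κ r (+ 0)
      ... | no r'≢r  = trans (setRow-other κ (+ 0) r'≢r)
                         (outside≡0 r' λ { (here r'≡r) → r'≢r r'≡r ; (there r'∈L) → r'∉L r'∈L })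
      unchanged : ∀ {r'} c → κ′ r' ≡ + 0 → P r' c ≡ M r' c
      unchanged {r'} c κ′r'≡0 = trans (cong (λ a → a * M s c + M r' c) κ′r'≡0) (ℤP.+-identityˡ (M r' c))
      split : ∀ r' c → κ r' * M s c + M r' c ≡ setRow P r (λ c → κ r * P s c + P r c) r' c
      split r' c with r' Fin.≟ r
      ... | yes refl = sym (trans (cong-app (setRow-same P r _) c)
                         (cong₂ (λ a b → κ r * a + b) (unchanged c κ′s≡0) (unchanged c (setRow-same κ r (+ 0)))))
      ... | no r'≢r  = sym (trans (cong-app (setRow-other P _ r'≢r) c)
                         (cong (λ a → a * M s c + M r' c) (setRow-other κ (+ 0) r'≢r)))

  rowExpansion : ∀ M r {p} (κ : Fin p → ℤ) (rows : Fin p → Row m) →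
    G (setRow M r (λ c → sumℤ (λ k → κ k * rows k c))) ≡ sumℤ (λ k → κ k * G (setRow M r (rows k)))
  rowExpansion M r {zero}  κ rows = zeroRow M r
  rowExpansion M r {suc p} κ rows =
    trans (rowLinear M r (κ zero) (rows zero) _) (cong (_+_ (κ zero * G (setRow M r (rows zero))))
      (rowExpansion M r (κ ∘ suc) (rows ∘ suc)))

pairSign : ∀ {n} (a b : Fin (suc n)) → a ≢ b → ℤ
pairSign a b a≢b = sign (toℕ a) * sign (toℕ (punchOut a≢b))

pairSign-antisym : ∀ {n} (a b : Fin (suc n)) (a≢b : a ≢ b) (b≢a : b ≢ a) →
  pairSign a b a≢b ≡ - pairSign b a b≢a
pairSign-antisym zero zero a≢b _ = ⊥-elim (a≢b refl)
pairSign-antisym {suc n} zero (suc b) _ _ = begin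
  + 1 * sign (toℕ b)                ≡⟨ flip (sign (toℕ b)) ⟩
  - (- sign (toℕ b) * + 1)          ≡⟨ cong (λ s → - (s * + 1)) (sym (sign-suc (toℕ b))) ⟩
  - (sign (suc (toℕ b)) * + 1)      ∎
  where
  open ≡-Reasoning
  flip : ∀ s → + 1 * s ≡ - (- s * + 1)
  flip = solve-∀
pairSign-antisym {suc n} (suc a) zero _ _ = begin
  sign (suc (toℕ a)) * + 1          ≡⟨ cong (_* + 1) (sign-suc (toℕ a)) ⟩
  - sign (toℕ a) * + 1              ≡⟨ flip (sign (toℕ a)) ⟩
  - (+ 1 * sign (toℕ a))            ∎
  where
  open ≡-Reasoning
  flip : ∀ s → - s * + 1 ≡ - (+ 1 * s)
  flip = solve-∀
pairSign-antisym {suc n} (suc a) (suc b) a≢b b≢a = begin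
  sign (suc (toℕ a)) * sign (suc (toℕ (punchOut a′≢b′)))  ≡⟨ cong₂ _*_ (sign-suc (toℕ a)) (sign-suc (toℕ (punchOut a′≢b′))) ⟩
  - sign (toℕ a) * - sign (toℕ (punchOut a′≢b′))         ≡⟨ neg*neg (sign (toℕ a)) (sign (toℕ (punchOut a′≢b′))) ⟩
  pairSign a b a′≢b′                                      ≡⟨ pairSign-antisym a b a′≢b′ b′≢a′ ⟩
  - pairSign b a b′≢a′                                    ≡⟨ cong -_ (sym (neg*neg (sign (toℕ b)) (sign (toℕ (punchOut b′≢a′))))) ⟩
  - (- sign (toℕ b) * - sign (toℕ (punchOut b′≢a′)))
    ≡⟨ cong -_ (sym (cong₂ _*_ (sign-suc (toℕ b)) (sign-suc (toℕ (punchOut b′≢a′))))) ⟩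
  - (sign (suc (toℕ b)) * sign (suc (toℕ (punchOut b′≢a′)))) ∎
  where
  open ≡-Reasoning
  a′≢b′ : a ≢ b
  a′≢b′ = a≢b ∘ cong suc
  b′≢a′ : b ≢ a
  b′≢a′ = b≢a ∘ cong suc
  neg*neg : ∀ x y → - x * - y ≡ x * y
  neg*neg = solve-∀

punchIn-punchOut-sym : ∀ {n} (a b : Fin (suc (suc n))) (a≢b : a ≢ b) (b≢a : b ≢ a) (c : Fin n) →
  punchIn a (punchIn (punchOut a≢b) c) ≡ punchIn b (punchIn (punchOut b≢a) c)
punchIn-punchOut-sym zero    zero    a≢b _ c = ⊥-elim (a≢b refl)
punchIn-punchOut-sym zero    (suc b) _   _ c = refl
punchIn-punchOut-sym (suc a) zero    _   _ c = refl
punchIn-punchOut-sym {suc n} (suc a) (suc b) _ _ zero    = refl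
punchIn-punchOut-sym {suc n} (suc a) (suc b) a≢b b≢a (suc c) =
  cong suc (punchIn-punchOut-sym a b (a≢b ∘ cong suc) (b≢a ∘ cong suc) c)

x≡-x⇒x≡0 : ∀ x → x ≡ - x → x ≡ + 0
x≡-x⇒x≡0 (+ zero)  _ = refl
x≡-x⇒x≡0 (+ suc n) ()
x≡-x⇒x≡0 -[1+ n ]  ()

-- Expanding along rows 0 and 1 writes det M as a double sum over column pairs (a, b);
-- when the two rows agree the (a, b) and (b, a) terms cancel.
det-firstRowsEqual : ∀ {m} (M : Mat (suc (suc m))) → (∀ c → M zero c ≡ M (suc zero) c) → det M ≡ + 0
det-firstRowsEqual {m} M row₀≡row₁ = x≡-x⇒x≡0 (det M) (begin
  det M                                       ≡⟨ sumℤ-cong expansionTerm≡ ⟩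
  sumℤ (λ a → sumℤ (pairTerm a))              ≡⟨ sumℤ-comm pairTerm ⟩
  sumℤ (λ b → sumℤ (λ a → pairTerm a b))      ≡⟨ sumℤ-cong (λ b → sumℤ-cong (λ a → pairTerm-antisym a b)) ⟩
  sumℤ (λ b → sumℤ (λ a → - pairTerm b a))    ≡⟨ sumℤ-cong (λ b → sumℤ-neg (pairTerm b)) ⟩
  sumℤ (λ b → - sumℤ (pairTerm b))            ≡⟨ sumℤ-neg (λ b → sumℤ (pairTerm b)) ⟩
  - sumℤ (λ a → sumℤ (pairTerm a))            ≡⟨ cong -_ (sym (sumℤ-cong expansionTerm≡)) ⟩
  - det M                                     ∎)
  where
  open ≡-Reasoning
  x : Row (suc (suc m))
  x = M zero
  rest : ∀ {a b : Fin (suc (suc m))} → a ≢ b → ℤ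
  rest {a} a≢b = det (λ r c → M (suc (suc r)) (punchIn a (punchIn (punchOut a≢b) c)))
  pairTerm′ : ∀ a b → Dec (a ≡ b) → ℤ
  pairTerm′ a b (yes _)  = + 0
  pairTerm′ a b (no a≢b) = pairSign a b a≢b * (x a * x b * rest a≢b)
  pairTerm : Fin (suc (suc m)) → Fin (suc (suc m)) → ℤ
  pairTerm a b = pairTerm′ a b (a Fin.≟ b)
  pairTerm-antisym : ∀ a b → pairTerm a b ≡ - pairTerm b a
  pairTerm-antisym a b with a Fin.≟ b | b Fin.≟ a
  ... | yes _   | yes _   = refl
  ... | yes a≡b | no b≢a  = ⊥-elim (b≢a (sym a≡b))
  ... | no a≢b  | yes b≡a = ⊥-elim (a≢b (sym b≡a))
  ... | no a≢b  | no b≢a  = begin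
    pairSign a b a≢b * (x a * x b * rest a≢b)       ≡⟨ cong₂ (λ s e → s * (x a * x b * e)) (pairSign-antisym a b a≢b b≢a)
                                                         (det-cong (λ r c → cong (M (suc (suc r))) (punchIn-punchOut-sym a b a≢b b≢a c))) ⟩
    - pairSign b a b≢a * (x a * x b * rest b≢a)     ≡⟨ reorder (pairSign b a b≢a) (x a) (x b) (rest b≢a) ⟩
    - (pairSign b a b≢a * (x b * x a * rest b≢a))   ∎
    where
    reorder : ∀ s u v e → - s * (u * v * e) ≡ - (s * (v * u * e))
    reorder = solve-∀
  pairTerm-punchIn : ∀ a k → sign (toℕ a) * x a * (sign (toℕ k) * M (suc zero) (punchIn a k) *
                       det (minor k (minor a M))) ≡ pairTerm a (punchIn a k)
  pairTerm-punchIn a k with a Fin.≟ punchIn a k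
  ... | yes a≡a+ = ⊥-elim (FinP.punchInᵢ≢i a k (sym a≡a+))
  ... | no a≢a+  = begin
    sign (toℕ a) * x a * (sign (toℕ k) * M (suc zero) (punchIn a k) * det (minor k (minor a M)))
      ≡⟨ cong₂ (λ k′ y → sign (toℕ a) * x a * (sign (toℕ k′) * y * det (λ r c → M (suc (suc r)) (punchIn a (punchIn k′ c)))))
           (sym (trans (FinP.punchOut-cong a refl) (FinP.punchOut-punchIn a))) (sym (row₀≡row₁ (punchIn a k))) ⟩
    sign (toℕ a) * x a * (sign (toℕ (punchOut a≢a+)) * x (punchIn a k) * rest a≢a+)
      ≡⟨ reorder (sign (toℕ a)) (x a) (sign (toℕ (punchOut a≢a+))) (x (punchIn a k)) (rest a≢a+) ⟩
    pairSign a (punchIn a k) a≢a+ * (x a * x (punchIn a k) * rest a≢a+) ∎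
    where
    reorder : ∀ s u t v e → s * u * (t * v * e) ≡ s * t * (u * v * e)
    reorder = solve-∀
  pairTerm-diag : ∀ a → pairTerm a a ≡ + 0
  pairTerm-diag a with a Fin.≟ a
  ... | yes _   = refl
  ... | no a≢a  = ⊥-elim (a≢a refl)
  expansionTerm≡ : ∀ a → expansionTerm M a ≡ sumℤ (pairTerm a)
  expansionTerm≡ a = begin
    expansionTerm M a
      ≡⟨ *-distribˡ-sumℤ (sign (toℕ a) * x a) (λ k → sign (toℕ k) * M (suc zero) (punchIn a k) * det (minor k (minor a M))) ⟩
    sumℤ (λ k → sign (toℕ a) * x a * (sign (toℕ k) * M (suc zero) (punchIn a k) * det (minor k (minor a M))))
      ≡⟨ sumℤ-cong (pairTerm-punchIn a) ⟩
    sumℤ (pairTerm a ∘ punchIn a)             ≡⟨ sym (ℤP.+-identityˡ _) ⟩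
    + 0 + sumℤ (pairTerm a ∘ punchIn a)       ≡⟨ cong (_+ sumℤ (pairTerm a ∘ punchIn a)) (sym (pairTerm-diag a)) ⟩
    pairTerm a a + sumℤ (pairTerm a ∘ punchIn a) ≡⟨ sym (sumℤ-punchIn a (pairTerm a)) ⟩
    sumℤ (pairTerm a)                         ∎

-- Swapping rows 1 and s + 2 negates every minor's determinant and makes the first two
-- rows equal.
det-firstRowRepeated : ∀ {m} → Alternating (det {suc m}) →
  (M : Mat (suc (suc m))) (s : Fin (suc m)) → (∀ c → M zero c ≡ M (suc s) c) → det M ≡ + 0
det-firstRowRepeated alt M zero    row₀≡row₁ = det-firstRowsEqual M row₀≡row₁
det-firstRowRepeated {suc m} alt M (suc s) row₀≡row = begin
  det M                                           ≡⟨ sym (ℤP.neg-involutive (det M)) ⟩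
  - (- det M)                                     ≡⟨ cong -_ (sym (sumℤ-neg (expansionTerm M))) ⟩
  - sumℤ (λ j → - expansionTerm M j)              ≡⟨ cong -_ (sym (sumℤ-cong swappedTerm)) ⟩
  - det M′
    ≡⟨ cong -_ (det-firstRowsEqual M′ (λ c → trans fixed₀ (trans (row₀≡row c) moved₁))) ⟩
  - + 0                                           ≡⟨⟩
  + 0                                             ∎
  where
  open ≡-Reasoning
  one≢2+s : Fin.suc {suc (suc m)} zero ≢ suc (suc s)
  one≢2+s ()
  M′ : Mat (suc (suc (suc m)))
  M′ = swapRows M (suc zero) (suc (suc s))
  fixed₀ : ∀ {c} → M′ zero c ≡ M zero c
  fixed₀ {c} = cong-app (swapRows-other M {suc zero} {suc (suc s)} {zero} (λ ()) (λ ())) c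
  moved₁ : ∀ {c} → M (suc (suc s)) c ≡ M′ (suc zero) c
  moved₁ {c} = sym (cong-app (swapRows-fst M one≢2+s) c)
  isAlt : IsAlternatingForm (det {suc (suc m)})
  isAlt = record { ext = det-cong ; rowLinear = det-rowLinear ; alternating = alt }
  swappedTerm : ∀ j → expansionTerm M′ j ≡ - expansionTerm M j
  swappedTerm j = begin
    sign (toℕ j) * M′ zero j * det (minor j M′)
      ≡⟨ cong₂ (λ a d → sign (toℕ j) * a * d) fixed₀
           (det-cong (λ r → cong-app (swapRows-map (_∘ punchIn j) (tail M) {zero} {suc s} (λ ()) r))) ⟩
    sign (toℕ j) * M zero j * det (swapRows (minor j M) zero (suc s))
      ≡⟨ cong (sign (toℕ j) * M zero j *_) (AlternatingForm.swapRows-neg isAlt (minor j M) {zero} {suc s} (λ ())) ⟩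
    sign (toℕ j) * M zero j * - det (minor j M)
      ≡⟨ sym (ℤP.neg-distribʳ-* (sign (toℕ j) * M zero j) (det (minor j M))) ⟩
    - expansionTerm M j ∎

alternating-suc : ∀ {m} → Alternating (det {m}) → Alternating (det {suc m})
alternating-suc alt M {zero}  {zero}  r≢s _ = ⊥-elim (r≢s refl)
alternating-suc alt M {suc r} {suc s} r≢s rows≡ = sumℤ-zero λ j → begin
  sign (toℕ j) * M zero j * det (minor j M)
    ≡⟨ cong (sign (toℕ j) * M zero j *_) (alt (minor j M) (r≢s ∘ cong suc) (rows≡ ∘ punchIn j)) ⟩
  sign (toℕ j) * M zero j * + 0             ≡⟨ ℤP.*-zeroʳ (sign (toℕ j) * M zero j) ⟩
  + 0                                       ∎
  where open ≡-Reasoning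
alternating-suc {suc m} alt M {zero}  {suc s} _ rows≡ = det-firstRowRepeated alt M s rows≡
alternating-suc {suc m} alt M {suc r} {zero}  _ rows≡ = det-firstRowRepeated alt M r (sym ∘ rows≡)

det-alternating : ∀ {m} → Alternating (det {m})
det-alternating {zero}  M {()}
det-alternating {suc m} = alternating-suc det-alternating

idMat : ∀ {m} → Mat m
idMat = unit

permMatrix : ∀ {m} → (Fin m → Fin m) → Mat m
permMatrix σ r = unit (σ r)

cycleToFront : ∀ {m} → Fin (suc m) → Fin (suc m) → Fin (suc m)
cycleToFront k zero    = k
cycleToFront k (suc r) = punchIn k r

punchIn-inject₁-self : ∀ {m} (j : Fin m) → punchIn (inject₁ j) j ≡ suc j
punchIn-inject₁-self zero    = refl
punchIn-inject₁-self (suc j) = cong suc (punchIn-inject₁-self j)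

punchIn-suc-self : ∀ {m} (j : Fin m) → punchIn (suc j) j ≡ inject₁ j
punchIn-suc-self zero    = refl
punchIn-suc-self (suc j) = cong suc (punchIn-suc-self j)

punchIn-suc≡punchIn-inject₁ : ∀ {m} {j r : Fin m} → r ≢ j → punchIn (suc j) r ≡ punchIn (inject₁ j) r
punchIn-suc≡punchIn-inject₁ {j = zero}  {zero}  r≢j = ⊥-elim (r≢j refl)
punchIn-suc≡punchIn-inject₁ {j = suc j} {zero}  r≢j = refl
punchIn-suc≡punchIn-inject₁ {j = zero}  {suc r} r≢j = refl
punchIn-suc≡punchIn-inject₁ {j = suc j} {suc r} r≢j = cong suc (punchIn-suc≡punchIn-inject₁ (r≢j ∘ cong suc))

cycleToFront-suc : ∀ {m} (j : Fin m) r → cycleToFront (suc j) r ≡ swapRows (cycleToFront (inject₁ j)) zero (suc j) r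
cycleToFront-suc j zero = sym (trans (swapRows-fst (cycleToFront (inject₁ j)) {zero} {suc j} (λ ())) (punchIn-inject₁-self j))
cycleToFront-suc j (suc r) with r Fin.≟ j
... | yes refl = trans (punchIn-suc-self r) (sym (swapRows-snd (cycleToFront (inject₁ r)) zero (suc r)))
... | no r≢j   = trans (punchIn-suc≡punchIn-inject₁ r≢j)
                   (sym (swapRows-other (cycleToFront (inject₁ j)) {zero} {suc j} {suc r} (λ ()) (r≢j ∘ FinP.suc-injective)))

G-cycleToFront : ∀ {m} {G : Mat (suc m) → ℤ} → IsAlternatingForm G →
  ∀ k → G (permMatrix (cycleToFront k)) ≡ sign (toℕ k) * G idMat
G-cycleToFront {m} {G} isAlt = <-weakInduction P P-zero P-suc
  where
  open IsAlternatingForm isAlt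
  P : Fin (suc m) → Set
  P k = G (permMatrix (cycleToFront k)) ≡ sign (toℕ k) * G idMat
  P-zero : P zero
  P-zero = trans (ext λ { zero c → refl ; (suc r) c → refl }) (sym (ℤP.*-identityˡ (G idMat)))
  P-suc : ∀ j → P (inject₁ j) → P (suc j)
  P-suc j P-j = begin
    G (permMatrix (cycleToFront (suc j)))
      ≡⟨ ext (λ r → cong-app (trans (cong unit (cycleToFront-suc j r))
                                   (swapRows-map unit (cycleToFront (inject₁ j)) {zero} {suc j} (λ ()) r))) ⟩
    G (swapRows (permMatrix (cycleToFront (inject₁ j))) zero (suc j))
      ≡⟨ AlternatingForm.swapRows-neg isAlt (permMatrix (cycleToFront (inject₁ j))) {zero} {suc j} (λ ()) ⟩
    - G (permMatrix (cycleToFront (inject₁ j)))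
      ≡⟨ cong -_ P-j ⟩
    - (sign (toℕ (inject₁ j)) * G idMat)
      ≡⟨ ℤP.neg-distribˡ-* (sign (toℕ (inject₁ j))) (G idMat) ⟩
    - sign (toℕ (inject₁ j)) * G idMat
      ≡⟨ cong (λ t → - sign t * G idMat) (FinP.toℕ-inject₁ j) ⟩
    - sign (toℕ j) * G idMat
      ≡⟨ cong (_* G idMat) (sym (sign-suc (toℕ j))) ⟩
    sign (toℕ (suc j)) * G idMat ∎
    where open ≡-Reasoning

embedMinor : ∀ {m} → Fin (suc m) → Mat m → Mat (suc m)
embedMinor k N zero    = unit k
embedMinor k N (suc r) = insertAt (N r) k (+ 0)

embedMinor-setRow : ∀ {m} k (N : Mat m) r x r′ c →
  embedMinor k (setRow N r x) r′ c ≡ setRow (embedMinor k N) (suc r) (λ c → insertAt x k (+ 0) c) r′ c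
embedMinor-setRow k N r x zero     c = refl
embedMinor-setRow k N r x (suc r′) c = cong-app (setRow-map (λ row → insertAt row k (+ 0)) N r x r′) c

embedMinor-isAlternatingForm : ∀ {m} {G : Mat (suc m) → ℤ} → IsAlternatingForm G → ∀ k →
  IsAlternatingForm (G ∘ embedMinor k)
embedMinor-isAlternatingForm {m} {G} isAlt k = record
  { ext         = λ N≗N′ → ext (embedMinor-cong N≗N′)
  ; rowLinear   = linear
  ; alternating = λ N r≢s rows≡ → alternating (embedMinor k N) (r≢s ∘ FinP.suc-injective) (insertAt-cong k rows≡)
  }
  where
  open IsAlternatingForm isAlt
  embedMinor-cong : ∀ {N N′ : Mat m} → (∀ r c → N r c ≡ N′ r c) → ∀ r c → embedMinor k N r c ≡ embedMinor k N′ r c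
  embedMinor-cong N≗N′ zero    c = refl
  embedMinor-cong N≗N′ (suc r) c = insertAt-cong k (N≗N′ r) c
  linear : RowLinear (G ∘ embedMinor k)
  linear N r t x y = begin
    G (embedMinor k (setRow N r (λ c → t * x c + y c)))
      ≡⟨ ext (embedMinor-setRow k N r _) ⟩
    G (setRow E (suc r) (λ c → insertAt (λ c → t * x c + y c) k (+ 0) c))
      ≡⟨ ext (setRow-cong E (suc r) (insertAt-linear k t x y)) ⟩
    G (setRow E (suc r) (λ c → t * insertAt x k (+ 0) c + insertAt y k (+ 0) c))
      ≡⟨ rowLinear E (suc r) t _ _ ⟩
    t * G (setRow E (suc r) (λ c → insertAt x k (+ 0) c)) + G (setRow E (suc r) (λ c → insertAt y k (+ 0) c))
      ≡⟨ sym (cong₂ (λ a b → t * a + b) (ext (embedMinor-setRow k N r x)) (ext (embedMinor-setRow k N r y))) ⟩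
    t * G (embedMinor k (setRow N r x)) + G (embedMinor k (setRow N r y)) ∎
    where
    open ≡-Reasoning
    E = embedMinor k N

embedMinor-idMat : ∀ {m} (k : Fin (suc m)) r c → embedMinor k idMat r c ≡ permMatrix (cycleToFront k) r c
embedMinor-idMat k zero    c = refl
embedMinor-idMat k (suc r) c with k Fin.≟ c
... | yes refl = trans (insertAt-lookup (unit r) k (+ 0)) (sym (unit-off (FinP.punchInᵢ≢i k r)))
... | no k≢c   = trans (insertAt-punchOut (unit r) (+ 0) k≢c) (unit-cong-↔
  (λ r≡c′ → trans (cong (punchIn k) r≡c′) (FinP.punchIn-punchOut k≢c))
  (λ k+r≡c → FinP.punchIn-injective k r (punchOut k≢c) (trans k+r≡c (sym (FinP.punchIn-punchOut k≢c)))))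

G-firstRowUnit≡G-embedMinor : ∀ {m} {G : Mat (suc m) → ℤ} → IsAlternatingForm G → ∀ (A : Mat (suc m)) k →
  G (setRow A zero (unit k)) ≡ G (embedMinor k (minor k A))
G-firstRowUnit≡G-embedMinor {m} {G} isAlt A k = sym (begin
  G (embedMinor k (minor k A))                  ≡⟨ ext cleared ⟩
  G (λ r c → κ r * M zero c + M r c)            ≡⟨ AlternatingForm.addMultiplesOfRow isAlt M zero κ refl ⟩
  G M                                           ∎)
  where
  open ≡-Reasoning
  open IsAlternatingForm isAlt
  M : Mat (suc m)
  M = setRow A zero (unit k)
  κ : Row (suc m)
  κ zero    = + 0
  κ (suc r) = - A (suc r) k
  cleared : ∀ r c → embedMinor k (minor k A) r c ≡ κ r * M zero c + M r c
  cleared zero    c = sym (ℤP.+-identityˡ (unit k c))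
  cleared (suc r) c with k Fin.≟ c
  ... | yes refl = trans (insertAt-lookup (minor k A r) k (+ 0))
                     (sym (cancel (A (suc r) k)))
    where
    cancel : ∀ a → - a * + 1 + a ≡ + 0
    cancel = solve-∀
  ... | no k≢c   = trans (insertAt-punchOut (minor k A r) (+ 0) k≢c)
                     (trans (cong (A (suc r)) (FinP.punchIn-punchOut k≢c))
                       (sym (drop (A (suc r) k) (A (suc r) c))))
    where
    drop : ∀ a b → - a * + 0 + b ≡ b
    drop = solve-∀

-- Expand row 0 in unit vectors. With first row e_k, clearing column k turns G into an
-- alternating form of the minor at k, and moving row k to the front costs sign k.
alternatingForm-unique : ∀ {m} {G : Mat m → ℤ} → IsAlternatingForm G → ∀ A → G A ≡ det A * G idMat
alternatingForm-unique {zero}  isAlt A = trans (IsAlternatingForm.ext isAlt (λ ())) (sym (ℤP.*-identityˡ _))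
alternatingForm-unique {suc m} {G} isAlt A = begin
  G A
    ≡⟨ ext row₀-expanded ⟩
  G (setRow A zero (λ c → sumℤ (λ k → A zero k * unit k c)))
    ≡⟨ AlternatingForm.rowExpansion isAlt A zero (A zero) unit ⟩
  sumℤ (λ k → A zero k * G (setRow A zero (unit k)))
    ≡⟨ sumℤ-cong (λ k → cong (A zero k *_) (G-firstRowUnit≡G-embedMinor isAlt A k)) ⟩
  sumℤ (λ k → A zero k * G (embedMinor k (minor k A)))
    ≡⟨ sumℤ-cong (λ k → cong (A zero k *_) (alternatingForm-unique (embedMinor-isAlternatingForm isAlt k) (minor k A))) ⟩
  sumℤ (λ k → A zero k * (det (minor k A) * G (embedMinor k idMat)))
    ≡⟨ sumℤ-cong (λ k → cong (λ g → A zero k * (det (minor k A) * g)) (trans (ext (embedMinor-idMat k)) (G-cycleToFront isAlt k))) ⟩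
  sumℤ (λ k → A zero k * (det (minor k A) * (sign (toℕ k) * G idMat)))
    ≡⟨ sumℤ-cong (λ k → reorder (A zero k) (det (minor k A)) (sign (toℕ k)) (G idMat)) ⟩
  sumℤ (λ k → expansionTerm A k * G idMat)
    ≡⟨ sym (*-distribʳ-sumℤ (G idMat) (expansionTerm A)) ⟩
  det A * G idMat ∎
  where
  open ≡-Reasoning
  open IsAlternatingForm isAlt
  row₀-expanded : ∀ r c → A r c ≡ setRow A zero (λ c → sumℤ (λ k → A zero k * unit k c)) r c
  row₀-expanded zero    c = unit-expansion (A zero) c
  row₀-expanded (suc r) c = refl
  reorder : ∀ a d s g → a * (d * (s * g)) ≡ s * a * d * g
  reorder = solve-∀

infixl 7 _*ᴹ_
_*ᴹ_ : ∀ {m} → Mat m → Mat m → Mat m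
(A *ᴹ B) r c = sumℤ (λ k → A r k * B k c)

det-*ᴹ : ∀ {m} (A B : Mat m) → det (A *ᴹ B) ≡ det A * det B
det-*ᴹ {m} A B = begin
  det (A *ᴹ B)              ≡⟨ alternatingForm-unique isAlt A ⟩
  det A * det (idMat *ᴹ B)  ≡⟨ cong (det A *_) (det-cong (λ r c → sumℤ-unit r (λ k → B k c))) ⟩
  det A * det B             ∎
  where
  open ≡-Reasoning
  rowTimes : Row m → Row m
  rowTimes x c = sumℤ (λ k → x k * B k c)
  product-setRow : ∀ X r x r′ c → (setRow X r x *ᴹ B) r′ c ≡ setRow (X *ᴹ B) r (rowTimes x) r′ c
  product-setRow X r x r′ c = cong-app (setRow-map rowTimes X r x r′) c
  isAlt : IsAlternatingForm (λ X → det (X *ᴹ B))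
  isAlt = record
    { ext         = λ X≗Y → det-cong (λ r c → sumℤ-cong (λ k → cong (_* B k c) (X≗Y r k)))
    ; rowLinear   = λ X r t x y → begin
        det (setRow X r (λ c → t * x c + y c) *ᴹ B)
          ≡⟨ det-cong (product-setRow X r _) ⟩
        det (setRow (X *ᴹ B) r (rowTimes (λ c → t * x c + y c)))
          ≡⟨ det-cong (setRow-cong (X *ᴹ B) r (λ c → sumℤ-linear t (λ k → distrib t (x k) (y k) (B k c)))) ⟩
        det (setRow (X *ᴹ B) r (λ c → t * rowTimes x c + rowTimes y c))
          ≡⟨ det-rowLinear (X *ᴹ B) r t (rowTimes x) (rowTimes y) ⟩
        t * det (setRow (X *ᴹ B) r (rowTimes x)) + det (setRow (X *ᴹ B) r (rowTimes y))
          ≡⟨ sym (cong₂ (λ a b → t * a + b) (det-cong (product-setRow X r x)) (det-cong (product-setRow X r y))) ⟩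
        t * det (setRow X r x *ᴹ B) + det (setRow X r y *ᴹ B) ∎
    ; alternating = λ X r≢s rows≡ → det-alternating (X *ᴹ B) r≢s (λ c → sumℤ-cong (λ k → cong (_* B k c) (rows≡ k)))
    }
    where
    distrib : ∀ t a b e → (t * a + b) * e ≡ t * (a * e) + b * e
    distrib = solve-∀

det-zeroFirstColumn : ∀ {m} (M : Mat (suc m)) → (∀ r → M r zero ≡ + 0) → det M ≡ + 0
det-zeroFirstColumn {zero}  M col₀≡0 = sumℤ-zero {f = expansionTerm M} λ where
  zero     → cong (λ a → + 1 * a * + 1) (col₀≡0 zero)
  (suc ())
det-zeroFirstColumn {suc m} M col₀≡0 = sumℤ-zero {f = expansionTerm M} λ where
  zero    → cong (λ a → + 1 * a * det (minor zero M)) (col₀≡0 zero)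
  (suc j) → trans (cong (sign (toℕ (suc j)) * M zero (suc j) *_) (det-zeroFirstColumn (minor (suc j) M) (col₀≡0 ∘ suc)))
              (ℤP.*-zeroʳ (sign (toℕ (suc j)) * M zero (suc j)))

det-minor-suc-zeroBelow : ∀ {m} (M : Mat (suc m)) → (∀ r → M (suc r) zero ≡ + 0) → ∀ j → det (minor (suc j) M) ≡ + 0
det-minor-suc-zeroBelow {suc m} M col₀≡0 j = det-zeroFirstColumn (minor (suc j) M) col₀≡0

det-firstColumn-zeroBelow : ∀ {m} (M : Mat (suc m)) → (∀ r → M (suc r) zero ≡ + 0) →
  det M ≡ M zero zero * det (λ r c → M (suc r) (suc c))
det-firstColumn-zeroBelow {m} M col₀≡0 = begin
  det M                                                ≡⟨ sumℤ-punchIn zero (expansionTerm M) ⟩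
  + 1 * M zero zero * D + sumℤ (expansionTerm M ∘ suc)
    ≡⟨ cong₂ _+_ (cong (_* D) (ℤP.*-identityˡ (M zero zero))) (sumℤ-zero below≡0) ⟩
  M zero zero * D + + 0                                ≡⟨ ℤP.+-identityʳ _ ⟩
  M zero zero * D                                      ∎
  where
  open ≡-Reasoning
  D = det (λ r c → M (suc r) (suc c))
  below≡0 : ∀ j → expansionTerm M (suc j) ≡ + 0
  below≡0 j = trans (cong (sign (toℕ (suc j)) * M zero (suc j) *_) (det-minor-suc-zeroBelow M col₀≡0 j))
                (ℤP.*-zeroʳ (sign (toℕ (suc j)) * M zero (suc j)))

productℤ : ∀ {m} → Row m → ℤ
productℤ = Πℤ.sum

det-scaleColumns : ∀ {m} (K : Row m) (W : Mat m) → det (λ r c → K c * W r c) ≡ productℤ K * det W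
det-scaleColumns {zero}  K W = refl
det-scaleColumns {suc m} K W = begin
  sumℤ (λ j → sign (toℕ j) * (K j * W zero j) * det (λ r c → K (punchIn j c) * minor j W r c))
    ≡⟨ sumℤ-cong (λ j → cong (sign (toℕ j) * (K j * W zero j) *_) (det-scaleColumns (K ∘ punchIn j) (minor j W))) ⟩
  sumℤ (λ j → sign (toℕ j) * (K j * W zero j) * (productℤ (K ∘ punchIn j) * det (minor j W)))
    ≡⟨ sumℤ-cong (λ j → trans (reorder (sign (toℕ j)) (K j) (W zero j) _ _)
                          (cong (_* expansionTerm W j) (sym (Πℤ.sum-remove {i = j} K)))) ⟩
  sumℤ (λ j → productℤ K * expansionTerm W j)
    ≡⟨ sym (*-distribˡ-sumℤ (productℤ K) (expansionTerm W)) ⟩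
  productℤ K * det W ∎
  where
  open ≡-Reasoning
  reorder : ∀ s k w p d → s * (k * w) * (p * d) ≡ (k * p) * (s * w * d)
  reorder = solve-∀

∣productℤ∣≥1 : ∀ {m} (K : Row m) → (∀ c → 1 ≤ ∣ K c ∣) → 1 ≤ ∣ productℤ K ∣
∣productℤ∣≥1 {zero}  K _      = s≤s z≤n
∣productℤ∣≥1 {suc m} K 1≤∣K∣ =
  ℕP.≤-trans (ℕP.*-mono-≤ (1≤∣K∣ zero) (∣productℤ∣≥1 (K ∘ suc) (1≤∣K∣ ∘ suc)))
    (ℕP.≤-reflexive (sym (ℤP.abs-* (K zero) (productℤ (K ∘ suc)))))

∣det∣-≤-scaleColumns : ∀ {m} (K : Row m) (W : Mat m) → (∀ c → 1 ≤ ∣ K c ∣) →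
  ∣ det W ∣ ≤ ∣ det (λ r c → K c * W r c) ∣
∣det∣-≤-scaleColumns K W 1≤∣K∣ = begin
  ∣ det W ∣                              ≤⟨ ℕP.m≤n*m ∣ det W ∣ ∣ productℤ K ∣ ⦃ ℕ.>-nonZero (∣productℤ∣≥1 K 1≤∣K∣) ⦄ ⟩
  ∣ productℤ K ∣ ℕ.* ∣ det W ∣          ≡⟨ sym (ℤP.abs-* (productℤ K) (det W)) ⟩
  ∣ productℤ K * det W ∣                 ≡⟨ cong ∣_∣ (sym (det-scaleColumns K W)) ⟩
  ∣ det (λ r c → K c * W r c) ∣          ∎
  where open ℕP.≤-Reasoning

content-∣ : ∀ {m} (v : Row m) k → content v ∣ ∣ v k ∣
content-∣ {m} v k = go (allFin m) (∈-allFin k)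
  where
  go : ∀ L → k ∈ L → foldr (λ j acc → gcd ∣ v j ∣ acc) 0 L ∣ ∣ v k ∣
  go (j ∷ L) (here refl) = gcd[m,n]∣m ∣ v j ∣ _
  go (j ∷ L) (there k∈L) = ∣-trans (gcd[m,n]∣n ∣ v j ∣ _) (go L k∈L)

/ℕ-exact : ∀ x d .{{_ : ℕ.NonZero d}} → d ∣ ∣ x ∣ → x ≡ + d * (x /ℕ d)
/ℕ-exact (+ n) d d∣n = begin
  + n                 ≡⟨ cong +_ (sym (trans (ℕP.*-comm d (n ℕ./ d)) (m/n*n≡m d∣n))) ⟩
  + (d ℕ.* (n ℕ./ d)) ≡⟨ ℤP.pos-* d (n ℕ./ d) ⟩
  + d * + (n ℕ./ d)   ∎
  where open ≡-Reasoning
/ℕ-exact -[1+ n ] d d∣n with suc n ℕ.% d in rem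
... | suc _ = ⊥-elim (ℕP.1+n≢0 (trans (sym rem) (n∣m⇒m%n≡0 (suc n) d d∣n)))
... | zero  = begin
  -[1+ n ]                    ≡⟨ cong -_ (/ℕ-exact (+ suc n) d d∣n) ⟩
  - (+ d * + (suc n ℕ./ d))   ≡⟨ ℤP.neg-distribʳ-* (+ d) (+ (suc n ℕ./ d)) ⟩
  + d * - + (suc n ℕ./ d)     ∎
  where open ≡-Reasoning

primPart-scales : ∀ {m} (z : Row m) → ∃[ k ] (1 ≤ k × ∀ r → z r ≡ + k * primPart z r)
primPart-scales z = scales (content z) (content-∣ z)
  where
  -- for the zero vector the content is 0 and divBy leaves the entries unchanged
  scales : ∀ d → (∀ r → d ∣ ∣ z r ∣) → ∃[ k ] (1 ≤ k × ∀ r → z r ≡ + k * divBy (z r) d)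
  scales zero    _   = 1 , s≤s z≤n , λ r → sym (ℤP.*-identityˡ (z r))
  scales (suc d) d∣z = suc d , s≤s z≤n , λ r → /ℕ-exact (z r) (suc d) (d∣z r)

∣det∣-≤-primPartColumns : ∀ {m} (Z : Mat m) → ∣ det (λ r c → primPart (λ r′ → Z r′ c) r) ∣ ≤ ∣ det Z ∣
∣det∣-≤-primPartColumns Z = ℕP.≤-trans
  (∣det∣-≤-scaleColumns K W (λ c → proj₁ (proj₂ (scales c))))
  (ℕP.≤-reflexive (cong ∣_∣ (det-cong (λ r c → sym (proj₂ (proj₂ (scales c)) r)))))
  where
  scales = λ c → primPart-scales (λ r → Z r c)
  K : Row _
  K c = + proj₁ (scales c)
  W : Mat _
  W r c = primPart (λ r′ → Z r′ c) r

toℤ-identity : ∀ g u v p q → g ℕ.+ u ℕ.* p ≡ v ℕ.* q → + g + + u * + p ≡ + v * + q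
toℤ-identity g u v p q eq = begin
  + g + + u * + p         ≡⟨ cong (_+_ (+ g)) (sym (ℤP.pos-* u p)) ⟩
  + g + + (u ℕ.* p)       ≡⟨ sym (ℤP.pos-+ g (u ℕ.* p)) ⟩
  + (g ℕ.+ u ℕ.* p)       ≡⟨ cong +_ eq ⟩
  + (v ℕ.* q)             ≡⟨ ℤP.pos-* v q ⟩
  + v * + q               ∎
  where open ≡-Reasoning

gcd-bézoutℤ : ∀ a b → ∃[ x ] ∃[ y ] x * + a + y * + b ≡ + gcd a b
gcd-bézoutℤ a b with Bézout.identity (gcd-GCD a b)
... | Bézout.+- x y eq = + x , - + y , solved (+ x * + a) (+ y) (+ b) (+ gcd a b) (toℤ-identity (gcd a b) y x b a eq)
  where
  solved : ∀ X Y B G → G + Y * B ≡ X → X + - Y * B ≡ G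
  solved _ Y B G refl = cancel G Y B
    where
    cancel : ∀ G Y B → G + Y * B + - Y * B ≡ G
    cancel = solve-∀
... | Bézout.-+ x y eq = - + x , + y , solved (+ x) (+ a) (+ y * + b) (+ gcd a b) (toℤ-identity (gcd a b) x y a b eq)
  where
  solved : ∀ X A Y G → G + X * A ≡ Y → - X * A + Y ≡ G
  solved X A _ G refl = cancel G X A
    where
    cancel : ∀ G X A → - X * A + (G + X * A) ≡ G
    cancel = solve-∀

abs-as-multiple : ∀ z → ∃[ s ] s * z ≡ + ∣ z ∣
abs-as-multiple (+ n)    = + 1 , ℤP.*-identityˡ (+ n)
abs-as-multiple -[1+ n ] = - + 1 , ℤP.-1*i≡-i -[1+ n ]

inner-unitCombination : ∀ {m} k a b (w x : Row m) → ⟨ (λ r → a * unit k r + b * w r) , x ⟩ ≡ a * x k + b * ⟨ w , x ⟩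
inner-unitCombination k a b w x = begin
  sumℤ (λ r → (a * unit k r + b * w r) * x r)
    ≡⟨ sumℤ-cong (λ r → distrib a (unit k r) b (w r) (x r)) ⟩
  sumℤ (λ r → a * (unit k r * x r) + b * (w r * x r))
    ≡⟨ sumℤ-+ (λ r → a * (unit k r * x r)) (λ r → b * (w r * x r)) ⟩
  sumℤ (λ r → a * (unit k r * x r)) + sumℤ (λ r → b * (w r * x r))
    ≡⟨ sym (cong₂ _+_ (*-distribˡ-sumℤ a (λ r → unit k r * x r)) (*-distribˡ-sumℤ b (λ r → w r * x r))) ⟩
  a * sumℤ (λ r → unit k r * x r) + b * ⟨ w , x ⟩
    ≡⟨ cong (λ e → a * e + b * ⟨ w , x ⟩) (sumℤ-unit k x) ⟩
  a * x k + b * ⟨ w , x ⟩ ∎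
  where
  open ≡-Reasoning
  distrib : ∀ a e b w x → (a * e + b * w) * x ≡ a * (e * x) + b * (w * x)
  distrib = solve-∀

inner-combo : ∀ {ℓ p} (B : Fin p → Row ℓ) (y : Fin p → ℤ) (x : Row ℓ) →
  ⟨ combo B y , x ⟩ ≡ sumℤ (λ d → y d * ⟨ B d , x ⟩)
inner-combo B y x = begin
  sumℤ (λ r → sumℤ (λ d → y d * B d r) * x r)      ≡⟨ sumℤ-cong (λ r → *-distribʳ-sumℤ (x r) (λ d → y d * B d r)) ⟩
  sumℤ (λ r → sumℤ (λ d → y d * B d r * x r))      ≡⟨ sumℤ-comm (λ r d → y d * B d r * x r) ⟩
  sumℤ (λ d → sumℤ (λ r → y d * B d r * x r))      ≡⟨ sumℤ-cong (λ d → trans (sumℤ-cong (λ r → ℤP.*-assoc (y d) (B d r) (x r)))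
                                                                           (sym (*-distribˡ-sumℤ (y d) (λ r → B d r * x r)))) ⟩
  sumℤ (λ d → y d * ⟨ B d , x ⟩)                   ∎
  where open ≡-Reasoning

content-bézout : ∀ {m} (u : Row m) → ∃[ v ] ⟨ v , u ⟩ ≡ + content u
content-bézout {m} u = go (allFin m)
  where
  go : ∀ L → ∃[ v ] ⟨ v , u ⟩ ≡ + foldr (λ k acc → gcd ∣ u k ∣ acc) 0 L
  go []      = (λ _ → + 0) , sumℤ-zero {f = λ r → + 0 * u r} (λ _ → refl)
  go (k ∷ L) with go L | abs-as-multiple (u k) | gcd-bézoutℤ ∣ u k ∣ (foldr (λ k acc → gcd ∣ u k ∣ acc) 0 L)
  ... | w , ⟨w,u⟩≡g | s , s*uk≡∣uk∣ | x , y , bézout = (λ r → x * s * unit k r + y * w r) , (begin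
    ⟨ (λ r → x * s * unit k r + y * w r) , u ⟩      ≡⟨ inner-unitCombination k (x * s) y w u ⟩
    x * s * u k + y * ⟨ w , u ⟩
      ≡⟨ cong₂ (λ a b → a + y * b) (trans (ℤP.*-assoc x s (u k)) (cong (x *_) s*uk≡∣uk∣)) ⟨w,u⟩≡g ⟩
    x * + ∣ u k ∣ + y * + foldr (λ k acc → gcd ∣ u k ∣ acc) 0 L  ≡⟨ bézout ⟩
    + foldr (λ k acc → gcd ∣ u k ∣ acc) 0 (k ∷ L)   ∎)
    where open ≡-Reasoning

primitive-bézout : ∀ {m} (u : Row m) → Primitive u → ∃[ v ] ⟨ v , u ⟩ ≡ + 1
primitive-bézout u prim with content-bézout u
... | v , ⟨v,u⟩≡c = v , trans ⟨v,u⟩≡c (cong +_ prim)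

fromColumns : ∀ {m} → (Fin m → Row m) → Mat m
fromColumns cols r c = cols c r

∣det∣-mutualFactorisation : ∀ {m} {X Y : Mat m} (U V : Mat m) →
  (∀ r c → Y r c ≡ (U *ᴹ X) r c) → (∀ r c → X r c ≡ (V *ᴹ Y) r c) → ∣ det Y ∣ ≡ ∣ det X ∣
∣det∣-mutualFactorisation {X = X} {Y} U V Y≡UX X≡VY = ∣-antisym
  (divides ∣ det V ∣ (trans (cong ∣_∣ (trans (det-cong X≡VY) (det-*ᴹ V Y))) (ℤP.abs-* (det V) (det Y))))
  (divides ∣ det U ∣ (trans (cong ∣_∣ (trans (det-cong Y≡UX) (det-*ᴹ U X))) (ℤP.abs-* (det U) (det X))))

-- With U = (v ; B) and V = (u | y), where Σ_d y k d · B d = e_k - u_k v, both Y = U X and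
-- X = V Y hold, and Y has first column e₀ above the block of forms ⟨B d , cols (suc c)⟩.
∣det∣-perpCoordinates : ∀ {m} (cols : Fin (suc m) → Row (suc m)) (B : Fin m → Row (suc m)) (v : Row (suc m)) →
  ⟨ v , cols zero ⟩ ≡ + 1 → IsLatticeBasisOfPerp (cols zero) B →
  ∣ det (λ d c → ⟨ B d , cols (suc c) ⟩) ∣ ≡ ∣ det (fromColumns cols) ∣
∣det∣-perpCoordinates {m} cols B v ⟨v,u⟩≡1 (B⊥u , spans , _) = begin
  ∣ det (λ d c → ⟨ B d , cols (suc c) ⟩) ∣   ≡⟨ cong ∣_∣ (sym det-Y) ⟩
  ∣ det (U *ᴹ X) ∣                          ≡⟨ ∣det∣-mutualFactorisation U V (λ _ _ → refl) X≡VY ⟩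
  ∣ det X ∣                                 ∎
  where
  open ≡-Reasoning
  u = cols zero
  X = fromColumns cols
  U : Mat (suc m)
  U zero    = v
  U (suc d) = B d
  det-Y : det (U *ᴹ X) ≡ det (λ d c → ⟨ B d , cols (suc c) ⟩)
  det-Y = trans (det-firstColumn-zeroBelow (U *ᴹ X) B⊥u)
                (trans (cong (_* det (λ d c → ⟨ B d , cols (suc c) ⟩)) ⟨v,u⟩≡1) (ℤP.*-identityˡ _))
  x : Fin (suc m) → Row (suc m)
  x k r = + 1 * unit k r + - u k * v r
  x⊥u : ∀ k → ⟨ x k , u ⟩ ≡ + 0
  x⊥u k = begin
    ⟨ x k , u ⟩                       ≡⟨ inner-unitCombination k (+ 1) (- u k) v u ⟩
    + 1 * u k + - u k * ⟨ v , u ⟩     ≡⟨ cong (λ e → + 1 * u k + - u k * e) ⟨v,u⟩≡1 ⟩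
    + 1 * u k + - u k * + 1           ≡⟨ cancel (u k) ⟩
    + 0                               ∎
    where
    cancel : ∀ a → + 1 * a + - a * + 1 ≡ + 0
    cancel = solve-∀
  y : Fin (suc m) → Fin m → ℤ
  y k = proj₁ (spans (x k) (x⊥u k))
  V : Mat (suc m)
  V k zero    = u k
  V k (suc d) = y k d
  X≡VY : ∀ k c → X k c ≡ (V *ᴹ (U *ᴹ X)) k c
  X≡VY k c = sym (begin
    u k * ⟨ v , cols c ⟩ + sumℤ (λ d → y k d * ⟨ B d , cols c ⟩)
      ≡⟨ cong (_+_ (u k * ⟨ v , cols c ⟩)) (sym (inner-combo B (y k) (cols c))) ⟩
    u k * ⟨ v , cols c ⟩ + ⟨ combo B (y k) , cols c ⟩
      ≡⟨ cong (_+_ (u k * ⟨ v , cols c ⟩)) (sumℤ-cong (λ r → cong (_* cols c r) (proj₂ (spans (x k) (x⊥u k)) r))) ⟩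
    u k * ⟨ v , cols c ⟩ + ⟨ x k , cols c ⟩
      ≡⟨ cong (_+_ (u k * ⟨ v , cols c ⟩)) (inner-unitCombination k (+ 1) (- u k) v (cols c)) ⟩
    u k * ⟨ v , cols c ⟩ + (+ 1 * cols c k + - u k * ⟨ v , cols c ⟩)
      ≡⟨ cancel (u k) ⟨ v , cols c ⟩ (cols c k) ⟩
    cols c k ∎)
    where
    cancel : ∀ a p q → a * p + (+ 1 * q + - a * p) ≡ q
    cancel = solve-∀

≤-maxList : ∀ {A : Set} (h : A → ℕ) (xs : List A) {y} → Any (λ x → y ≤ h x) xs → y ≤ maxList (map h xs)
≤-maxList h (x ∷ xs) (here y≤hx)  = ℕP.≤-trans y≤hx (ℕP.m≤m⊔n (h x) _)
≤-maxList h (x ∷ xs) (there y≤xs) = ℕP.≤-trans (≤-maxList h xs y≤xs) (ℕP.m≤n⊔m (h x) _)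

maxList-lub : ∀ {A : Set} (h : A → ℕ) (xs : List A) {K} → (∀ x → h x ≤ K) → maxList (map h xs) ≤ K
maxList-lub h []       h≤K = z≤n
maxList-lub h (x ∷ xs) h≤K = ℕP.⊔-lub (h≤K x) (maxList-lub h xs h≤K)

allTuples-complete : ∀ k n (f : Fin k → Fin n) → Any (λ g → ∀ c → g c ≡ f c) (allTuples k n)
allTuples-complete zero    n f = here (λ ())
allTuples-complete (suc k) n f = concatMap⁺ _ (lose (∈-allFin (f zero))
  (map⁺ (Any.map (λ g≗f∘suc → λ { zero → refl ; (suc c) → g≗f∘suc c }) (allTuples-complete k n (f ∘ suc)))))

extendTuple : ∀ {k n} → Fin n → (Fin k → Fin n) → Fin (suc k) → Fin n
extendTuple i J zero    = i
extendTuple i J (suc c) = J c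

∣det∣≤index : ∀ {ℓ n} (a : Fin n → Fin ℓ → ℤ) (I : Fin ℓ → Fin n) → ∣ det (fromColumns (a ∘ I)) ∣ ≤ index a
∣det∣≤index {ℓ} {n} a I = ≤-maxList (λ J → ∣ det (fromColumns (a ∘ J)) ∣) (allTuples ℓ n)
  (Any.map (λ J≗I → ℕP.≤-reflexive (cong ∣_∣ (det-cong (λ r c → cong (λ j → a j r) (sym (J≗I c))))))
    (allTuples-complete ℓ n I))

lemma4p1 : (ℓ n : ℕ) (ℓ≤n : ℓ ≤ n) (σ : Fin n → Fin n → ℚ) (a : Fin n → Fin ℓ → ℤ) →
    IsRestriction ℓ≤n σ a → Normalized a →
    (i : Fin n) (B : Fin (pred ℓ) → Fin ℓ → ℤ) → IsLatticeBasisOfPerp (a i) B →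
    indexPerp a B ≤ index a
lemma4p1 zero    n ℓ≤n σ a _ (primitive-columns , _) i B basis with () ← primitive-columns i
lemma4p1 (suc m) n ℓ≤n σ a _ (primitive-columns , _) i B basis =
  maxList-lub (λ J → ∣ det (λ r c → restrictedForm B (a (J c)) r) ∣) (allTuples m n) λ J → begin
    ∣ det (λ r c → restrictedForm B (a (J c)) r) ∣   ≤⟨ ∣det∣-≤-primPartColumns (λ d c → ⟨ B d , a (J c) ⟩) ⟩
    ∣ det (λ d c → ⟨ B d , a (J c) ⟩) ∣              ≡⟨ ∣det∣-perpCoordinates (a ∘ extendTuple i J) B v ⟨v,aᵢ⟩≡1 basis ⟩
    ∣ det (fromColumns (a ∘ extendTuple i J)) ∣      ≤⟨ ∣det∣≤index a (extendTuple i J) ⟩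
    index a                                         ∎
  where
  open ℕP.≤-Reasoning
  v = proj₁ (primitive-bézout (a i) (primitive-columns i))
  ⟨v,aᵢ⟩≡1 = proj₂ (primitive-bézout (a i) (primitive-columns i))
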